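{- Let $\mathsf{G}$ be a global type. If $\mathsf{G}$ is bounded, then $\mathcal{S}(\mathsf{G})$ is semantically bounded.
   Context: Participants are ranged over by $\mathsf{p},\mathsf{q},\mathsf{r},\mathsf{s}$, messages (labels) by $\lambda$. Global types are the regular (finitely many distinct subterms) terms generated coinductively by $\mathsf{G} ::= \mathsf{p}\to\mathsf{q}:\{\lambda_i;\mathsf{G}_i\}_{i\in I} \mid \mathsf{End}$, with $I$ finite non-empty and $\lambda_h\neq\lambda_k$ for $h\ne k$. A communication is $\alpha=\mathsf{p}\mathsf{q}\lambda$, with $\mathrm{part}(\alpha)=\{\mathsf{p},\mathsf{q}\}$; a trace is a finite sequence of communications, $\mathrm{part}$ extended to traces by union, $|\sigma|$ its length. $\mathrm{Tr}(\mathsf{End})=\emptyset$, and $\mathrm{Tr}(\mathsf{p}\to\mathsf{q}:\{\lambda_i;\mathsf{G}_i\}_{i\in I})$ consists of $\mathsf{p}\mathsf{q}\lambda_j$ and $\mathsf{p}\mathsf{q}\lambda_j\cdot\sigma$ for $j\in I$, $\sigma\in\mathrm{Tr}(\mathsf{G}_j)$. For $\sigma\in \mathrm{Tr}(\mathsf{G})$, $\mathsf{G}_\sigma$ is the subterm of $\mathsf{G}$ reached after $\sigma$; the subtrees of $\mathsf{G}$ are $\mathsf{G}$ and the $\mathsf{G}_\sigma$. Depth: for a trace $\sigma$, $\mathrm{depth}(\mathsf{p},\sigma)=|\sigma_1\cdot\alpha|$ if $\sigma=\sigma_1\cdot\alpha\cdot\sigma_2$ with $\mathsf{p}\notin\mathrm{part}(\sigma_1)$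 and $\mathsf{p}\in\mathrm{part}(\alpha)$, and $0$ otherwise; $\mathrm{depth}(\mathsf{p},\mathsf{G})=\sup\{\mathrm{depth}(\mathsf{p},\sigma)\mid\sigma\in\mathrm{Tr}(\mathsf{G})\}$. $\mathsf{G}$ is bounded if $\mathrm{depth}(\mathsf{p},\mathsf{G}')$ is finite for every participant $\mathsf{p}$ and every subtree $\mathsf{G}'$ of $\mathsf{G}$. Event structure of a global type: permutation equivalence $\sim$ on traces is the least equivalence with $\sigma\cdot\alpha\cdot\alpha'\cdot\sigma'\sim\sigma\cdot\alpha'\cdot\alpha\cdot\sigma'$ whenever $\mathrm{part}(\alpha)\cap\mathrm{part}(\alpha')=\emptyset$; $[\sigma]$ is the class of $\sigma$. A non-empty trace $\sigma=\sigma[1]\cdots\sigma[n]$ is pointed if for every $1\le i<n$ there is $j$ with $i<j\le n$ and $\mathrm{part}(\sigma[i])\cap\mathrm{part}(\sigma[j])\neq\emptyset$. A g-event is $[\sigma]$ with $\sigma$ pointed. Causal prefixing: $\alpha\circ[\sigma]=[\alpha\cdot\sigma]$ if $\mathrm{part}(\alpha)\cap\mathrm{part}(\sigma)\ne\emptyset$, and $=[\sigma]$ otherwise; $\epsilon\circ\gamma=\gamma$, $(\alpha\cdot\sigma)\circ\gamma=\alpha\circ(\sigma\circ\gamma)$. $\mathrm{ev}(\sigma\cdot\alpha)=\sigma\circ[\alpha]$. On g-events: $\gamma\le\gamma'$ iff $\gamma=[\sigma]$, $\gamma'=[\sigma\cdot\sigma']$; $\gamma\#\gamma'$ iff $\gamma=[\sigma\cdot\mathsf{p}\mathsf{q}\lambda_1\cdot\sigma_1]$,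 $\gamma'=[\sigma\cdot\mathsf{p}\mathsf{q}\lambda_2\cdot\sigma_2]$ with $\lambda_1\ne\lambda_2$. $\mathcal{S}(\mathsf{G})=(\mathcal{E}(\mathsf{G}),\le_{\mathsf{G}},\#_{\mathsf{G}})$ where $\mathcal{E}(\mathsf{G})=\{\mathrm{ev}(\sigma)\mid\sigma\in\mathrm{Tr}(\mathsf{G})\}$ and the relations are the restrictions of $\le,\#$. Semantic boundedness: for $S=(E,\le,\#)$ of this form, a participant $\mathsf{p}$ belongs to $\mathrm{part}(S)$ if $\mathsf{p}\in\mathrm{part}(\gamma)$ for some $\gamma\in E$ (participants of the traces in $\gamma$). For $k\in\mathbb{N}$, $\mathrm{depth}_k(\mathsf{p},[\sigma])=|\sigma|$ if $\sigma=\sigma_1\cdot\alpha_1\cdots\sigma_k\cdot\alpha_k$ with $\mathsf{p}\in\mathrm{part}(\alpha_i)$ and $\mathsf{p}\notin\mathrm{part}(\sigma_i)$ for $i=1,\dots,k$, and $0$ otherwise; $\mathrm{depth}_k(\mathsf{p},S)=\sup\{\mathrm{depth}_k(\mathsf{p},\gamma)\mid\gamma\in E\}$. $S$ is semantically bounded if $\mathrm{depth}_k(\mathsf{p},S)$ is finite for every $\mathsf{p}\in\mathrm{part}(S)$ and every $k\in\mathbb{N}$. -}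

module Defs where

open import Data.Nat using (ℕ; zero; suc; _≤_; _≡ᵇ_)
open import Data.Bool using (Bool; true; false; if_then_else_; _∨_)
open import Data.Fin using (Fin)
open import Data.List using (List; []; _∷_; _++_; length; map)
open import Data.Bool.ListAction using (any)
open import Data.List.Relation.Unary.All using (All)
open import Data.List.Relation.Unary.Unique.Propositional using (Unique)
open import Data.List.Membership.Propositional using (_∈_)
open import Data.Product using (_×_; _,_; ∃; ∃-syntax; proj₁)
open import Data.Sum using (_⊎_)
open import Relation.Binary.PropositionalEquality using (_≡_; _≢_)
open import Relation.Nullary using (¬_)
open import Relation.Binary.Construct.Closure.Equivalence using (EqClosure)

Participant : Set
Participant = ℕ

Label : Set
Label = ℕ

record Comm : Set where
  constructor comm
  field
    sender   : Participant
    receiver : Participant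
    label    : Label
open Comm public

Trace : Set
Trace = List Comm

_∈partC_ : Participant → Comm → Set
p ∈partC α = p ≡ sender α ⊎ p ≡ receiver α

_∈part_ : Participant → Trace → Set
p ∈part σ = ∃[ α ] (α ∈ σ × p ∈partC α)

_∉part_ : Participant → Trace → Set
p ∉part σ = ¬ (p ∈part σ)

SharesC : Comm → Comm → Set
SharesC α β = ∃[ p ] (p ∈partC α × p ∈partC β)

-- Global types: regular terms, represented as the unfolding of a finite
-- rooted graph (every regular term arises this way).

data Node (n : ℕ) : Set where
  end : Node n
  msg : (p q : Participant) → (bs : List (Label × Fin n)) → Node n

WFNode : {n : ℕ} → Node n → Set
WFNode end = Data.Unit.⊤ where import Data.Unit
WFNode (msg p q bs) = (bs ≢ []) × Unique (map proj₁ bs)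

record GlobalType : Set where
  field
    size  : ℕ
    node  : Fin size → Node size
    wf    : (i : Fin size) → WFNode (node i)
    root  : Fin size
open GlobalType public

-- Path G i σ j : following trace σ from node i of the graph leads to node j
-- (so j represents the subterm (G_i)_σ).
data Path (G : GlobalType) : Fin (size G) → Trace → Fin (size G) → Set where
  done : ∀ {i} → Path G i [] i
  step : ∀ {i j k p q l bs σ} →
         node G i ≡ msg p q bs → (l , j) ∈ bs →
         Path G j σ k → Path G i (comm p q l ∷ σ) k

TrAt : (G : GlobalType) → Fin (size G) → Trace → Set
TrAt G i σ = (σ ≢ []) × ∃[ j ] Path G i σ j

Tr : GlobalType → Trace → Set
Tr G σ = TrAt G (root G) σ

Subtree : (G : GlobalType) → Fin (size G) → Set
Subtree G i = ∃[ σ ] Path G (root G) σ i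

-- depth(p, G') is finite (bounded by some N) for the subterm at node i:
-- for every σ ∈ Tr(G') written σ₁·α·σ₂ with p ∉ part(σ₁), p ∈ part(α),
-- we have |σ₁·α| ≤ N.  (Traces without p have depth 0.)
FiniteDepth : (G : GlobalType) → Participant → Fin (size G) → Set
FiniteDepth G p i =
  ∃[ N ] (∀ σ₁ α σ₂ → TrAt G i (σ₁ ++ α ∷ σ₂) →
            p ∉part σ₁ → p ∈partC α → suc (length σ₁) ≤ N)

Bounded : GlobalType → Set
Bounded G = ∀ (p : Participant) (i : Fin (size G)) → Subtree G i → FiniteDepth G p i

data Swap : Trace → Trace → Set where
  swap : ∀ σ α α' σ' → ¬ SharesC α α' →
         Swap (σ ++ α ∷ α' ∷ σ') (σ ++ α' ∷ α ∷ σ')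

_∼_ : Trace → Trace → Set
_∼_ = EqClosure Swap

-- Events: ev(σ) = [evRep σ], computed on representatives via causal
-- prefixing (well defined on classes since part is ∼-invariant).

sharesCᵇ : Comm → Comm → Bool
sharesCᵇ α β = (sender α ≡ᵇ sender β) ∨ (sender α ≡ᵇ receiver β)
             ∨ (receiver α ≡ᵇ sender β) ∨ (receiver α ≡ᵇ receiver β)

prefix : Comm → Trace → Trace
prefix α τ = if any (sharesCᵇ α) τ then α ∷ τ else τ

-- evRep' α σ is a representative of ev(α·σ)
evRep' : Comm → Trace → Trace
evRep' α [] = α ∷ []
evRep' α (β ∷ σ) = prefix α (evRep' β σ)

evRep : Trace → Trace
evRep [] = []
evRep (α ∷ σ) = evRep' α σ

InEvent : GlobalType → Trace → Set
InEvent G τ = ∃[ σ ] (Tr G σ × τ ∼ evRep σ)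

data KDecomp (p : Participant) : ℕ → Trace → Set where
  nil  : KDecomp p zero []
  cons : ∀ {k} σ₁ α τ → p ∉part σ₁ → p ∈partC α →
         KDecomp p k τ → KDecomp p (suc k) (σ₁ ++ α ∷ τ)

InPartS : GlobalType → Participant → Set
InPartS G p = ∃[ τ ] (InEvent G τ × p ∈part τ)

-- depth_k(p, S(G)) is finite: some N bounds depth_k(p, γ) for all γ ∈ E(G)
FiniteDepthK : GlobalType → Participant → ℕ → Set
FiniteDepthK G p k =
  ∃[ N ] (∀ τ → InEvent G τ → KDecomp p k τ → length τ ≤ N)

SemBounded : GlobalType → Set
SemBounded G = ∀ (p : Participant) → InPartS G p → ∀ (k : ℕ) → FiniteDepthK G p k

-- An event [τ] with depth_k(p, [τ]) > 0 is ev(σ) for some trace σ of G. Pointedness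
-- is invariant under permutation, so the last communication of τ, which involves p,
-- is the last communication of σ; hence every p-communication of σ causally precedes
-- it and survives in ev(σ). So σ itself splits into k blocks ending in p and is at
-- least as long as τ. Such traces have bounded length, by induction on k: in the
-- current subtree G' the first block has length at most depth(p, G') < ∞, and the
-- rest is a trace of one of the finitely many subtrees reachable within that many steps.

module Submission where

open import Defs
open import Data.Nat using (ℕ; zero; suc; _≤_; _+_; _⊔_; z≤n; s≤s; _≟_; _≡ᵇ_)
open import Data.Nat.Properties
  using (≡ᵇ⇒≡; ≡⇒≡ᵇ; ≤-refl; ≤-trans; ≤-reflexive; m≤n⇒m≤1+n; m≤m⊔n; m≤n⊔m; +-comm; +-suc; +-mono-≤;
         module ≤-Reasoning)
open import Data.Bool using (true; false; T; _∨_)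
open import Data.Bool.Properties using (T-∨; T-≡)
open import Data.Bool.ListAction using (any)
open import Data.Empty using (⊥-elim)
open import Data.Fin using (Fin)
open import Data.List using (List; []; _∷_; _++_; _∷ʳ_; length; filter)
open import Data.List.Properties
  using (length-++; filter-++; filter-accept; filter-reject; filter-none; ++-assoc; ++-conicalʳ; ∷ʳ-injectiveʳ)
open import Data.List.Membership.Propositional using (_∈_; lose)
open import Data.List.Relation.Unary.Any as Any using (Any; here; there)
open import Data.List.Relation.Unary.Any.Properties using (any⁺; any⁻)
open import Data.List.Relation.Unary.All as All using (All; []; _∷_)
open import Data.List.Relation.Binary.Permutation.Propositional
  using (_↭_; ↭-swap; ↭-refl; ↭-isEquivalence)
open import Data.List.Relation.Binary.Permutation.Propositional.Properties
  using (↭-length; filter-↭; Any-resp-↭; ++⁺ˡ)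
open import Data.Product using (_×_; _,_; proj₂; ∃; ∃-syntax; ∃₂)
open import Data.Sum using (_⊎_; inj₁; inj₂)
open import Function using (_∘_; id; Equivalence)
open import Relation.Binary.PropositionalEquality
  using (_≡_; _≢_; refl; sym; trans; cong; cong₂; subst; module ≡-Reasoning)
open import Relation.Nullary using (¬_; Dec; yes; no; contradiction)
open import Relation.Nullary.Decidable using (_⊎-dec_)
open import Relation.Binary.Construct.Closure.Equivalence using (fold; symmetric)
open import Relation.Binary.Construct.Closure.Symmetric using (fwd; bwd)
open import Relation.Binary.Construct.Closure.ReflexiveTransitive using (ε; _◅_)

open Equivalence using (to; from)

private
  variable
    p : Participant
    k : ℕ
    α ω : Comm
    σ τ ρ ρ′ : Trace

sharesCᵇ-sound : ∀ α β → T (sharesCᵇ α β) → SharesC α β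
sharesCᵇ-sound α β t with T-∨ .to t
... | inj₁ s≡s = sender α , inj₁ refl , inj₁ (≡ᵇ⇒≡ _ _ s≡s)
... | inj₂ t₁ with T-∨ .to t₁
...   | inj₁ s≡r = sender α , inj₁ refl , inj₂ (≡ᵇ⇒≡ _ _ s≡r)
...   | inj₂ t₂ with T-∨ .to t₂
...     | inj₁ r≡s = receiver α , inj₂ refl , inj₁ (≡ᵇ⇒≡ _ _ r≡s)
...     | inj₂ r≡r = receiver α , inj₂ refl , inj₂ (≡ᵇ⇒≡ _ _ r≡r)

sharesCᵇ-complete : ∀ α β → SharesC α β → T (sharesCᵇ α β)
sharesCᵇ-complete α β (_ , q∈α , q∈β) = T-∨ .from (sender-or-receiver q∈α q∈β)
  where
  s≡ᵇs = sender α ≡ᵇ sender β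
  s≡ᵇr = sender α ≡ᵇ receiver β
  r≡ᵇs = receiver α ≡ᵇ sender β
  r≡ᵇr = receiver α ≡ᵇ receiver β
  ≡⇒T : ∀ {q} {m n : ℕ} → q ≡ m → q ≡ n → T (m ≡ᵇ n)
  ≡⇒T e₁ e₂ = ≡⇒≡ᵇ _ _ (trans (sym e₁) e₂)
  sender-or-receiver : ∀ {q} → q ∈partC α → q ∈partC β → T s≡ᵇs ⊎ T (s≡ᵇr ∨ r≡ᵇs ∨ r≡ᵇr)
  sender-or-receiver (inj₁ e₁) (inj₁ e₂) = inj₁ (≡⇒T e₁ e₂)
  sender-or-receiver (inj₁ e₁) (inj₂ e₂) = inj₂ (T-∨ {s≡ᵇr} .from (inj₁ (≡⇒T e₁ e₂)))
  sender-or-receiver (inj₂ e₁) (inj₁ e₂) =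
    inj₂ (T-∨ {s≡ᵇr} .from (inj₂ (T-∨ {r≡ᵇs} .from (inj₁ (≡⇒T e₁ e₂)))))
  sender-or-receiver (inj₂ e₁) (inj₂ e₂) =
    inj₂ (T-∨ {s≡ᵇr} .from (inj₂ (T-∨ {r≡ᵇs} .from (inj₂ (≡⇒T e₁ e₂)))))

Swap-sym : Swap ρ ρ′ → Swap ρ′ ρ
Swap-sym (swap σ α α′ σ′ ¬sh) = swap σ α′ α σ′ (λ (q , q∈α′ , q∈α) → ¬sh (q , q∈α , q∈α′))

Swap⇒↭ : Swap ρ ρ′ → ρ ↭ ρ′
Swap⇒↭ (swap σ α α′ σ′ _) = ++⁺ˡ σ (↭-swap α α′ ↭-refl)

∼⇒↭ : ρ ∼ ρ′ → ρ ↭ ρ′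
∼⇒↭ = fold ↭-isEquivalence (λ s → Swap⇒↭ s)

data Pointed : Trace → Comm → Set where
  one  : Pointed (ω ∷ []) ω
  cons : Any (SharesC α) τ → Pointed τ ω → Pointed (α ∷ τ) ω

Pointed-∷ʳ : Pointed τ ω → ∃[ τ₀ ] τ ≡ τ₀ ∷ʳ ω
Pointed-∷ʳ one = [] , refl
Pointed-∷ʳ {α ∷ _} (cons _ pt) with Pointed-∷ʳ pt
... | τ₀ , refl = α ∷ τ₀ , refl

Pointed-∈ : Pointed τ ω → ω ∈ τ
Pointed-∈ one = here refl
Pointed-∈ (cons _ pt) = there (Pointed-∈ pt)

Pointed-swap : ∀ σ {α α′ σ′} → ¬ SharesC α α′ →
               Pointed (σ ++ α ∷ α′ ∷ σ′) ω → Pointed (σ ++ α′ ∷ α ∷ σ′) ω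
Pointed-swap [] ¬sh (cons (here sh) _) = contradiction sh ¬sh
Pointed-swap [] ¬sh (cons (there ()) one)
Pointed-swap [] ¬sh (cons (there α→σ′) (cons α′→ pt)) = cons (there α′→) (cons α→σ′ pt)
Pointed-swap (β ∷ []) ¬sh (cons β→ pt) =
  cons (Any-resp-↭ (Swap⇒↭ (swap [] _ _ _ ¬sh)) β→) (Pointed-swap [] ¬sh pt)
Pointed-swap (β ∷ γ ∷ σ) ¬sh (cons β→ pt) =
  cons (Any-resp-↭ (Swap⇒↭ (swap (γ ∷ σ) _ _ _ ¬sh)) β→) (Pointed-swap (γ ∷ σ) ¬sh pt)

Pointed-resp-Swap : Swap ρ ρ′ → Pointed ρ ω → Pointed ρ′ ω
Pointed-resp-Swap (swap σ _ _ _ ¬sh) = Pointed-swap σ ¬sh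

Pointed-resp-∼ : ρ ∼ ρ′ → Pointed ρ ω → Pointed ρ′ ω
Pointed-resp-∼ ε = id
Pointed-resp-∼ (fwd s ◅ r) = Pointed-resp-∼ r ∘ Pointed-resp-Swap s
Pointed-resp-∼ (bwd s ◅ r) = Pointed-resp-∼ r ∘ Pointed-resp-Swap (Swap-sym s)

_∈partC?_ : ∀ p α → Dec (p ∈partC α)
p ∈partC? α = (p ≟ sender α) ⊎-dec (p ≟ receiver α)

count : Participant → Trace → ℕ
count p τ = length (filter (p ∈partC?_) τ)

count-resp-∼ : ρ ∼ ρ′ → count p ρ ≡ count p ρ′
count-resp-∼ {p = p} = ↭-length ∘ filter-↭ (p ∈partC?_) ∘ ∼⇒↭

length-resp-∼ : ρ ∼ ρ′ → length ρ ≡ length ρ′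
length-resp-∼ = ↭-length ∘ ∼⇒↭

count-accept : p ∈partC α → count p (α ∷ τ) ≡ suc (count p τ)
count-accept {p} p∈α = cong length (filter-accept (p ∈partC?_) p∈α)

count-reject : ¬ p ∈partC α → count p (α ∷ τ) ≡ count p τ
count-reject {p} p∉α = cong length (filter-reject (p ∈partC?_) p∉α)

∉part⇒All : p ∉part σ → All (λ α → ¬ p ∈partC α) σ
∉part⇒All p∉σ = All.tabulate (λ α∈σ p∈α → p∉σ (_ , α∈σ , p∈α))

KDecomp-count : KDecomp p k τ → count p τ ≡ k
KDecomp-count nil = refl
KDecomp-count {p} {suc k} (cons σ₁ α τ p∉σ₁ p∈α kd) = begin
  length (filter P? (σ₁ ++ α ∷ τ))                   ≡⟨ cong length (filter-++ P? σ₁ (α ∷ τ)) ⟩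
  length (filter P? σ₁ ++ filter P? (α ∷ τ))         ≡⟨ length-++ (filter P? σ₁) ⟩
  length (filter P? σ₁) + length (filter P? (α ∷ τ)) ≡⟨ cong₂ _+_ (cong length (filter-none P? (∉part⇒All p∉σ₁)))
                                                                   (cong length (filter-accept P? p∈α)) ⟩
  suc (count p τ)                                    ≡⟨ cong suc (KDecomp-count kd) ⟩
  suc k                                              ∎
  where
  open ≡-Reasoning
  P? = p ∈partC?_

KDecomp-∷ʳ : KDecomp p (suc k) τ → ∃₂ λ τ₀ ω → τ ≡ τ₀ ∷ʳ ω × p ∈partC ω
KDecomp-∷ʳ {k = zero} (cons σ₁ α [] _ p∈α nil) = σ₁ , α , refl , p∈α
KDecomp-∷ʳ {k = suc _} (cons σ₁ α _ _ _ kd) with KDecomp-∷ʳ kd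
... | τ₀ , ω , refl , p∈ω = σ₁ ++ α ∷ τ₀ , ω , sym (++-assoc σ₁ (α ∷ τ₀) _) , p∈ω

KDecomp-last : KDecomp p (suc k) τ → Pointed τ ω → p ∈partC ω
KDecomp-last {p} kd pt with KDecomp-∷ʳ kd | Pointed-∷ʳ pt
... | τ₀ , _ , refl , p∈ω′ | τ₁ , τ≡ = subst (p ∈partC_) (∷ʳ-injectiveʳ τ₀ τ₁ τ≡) p∈ω′

lastOf : Comm → Trace → Comm
lastOf α [] = α
lastOf _ (β ∷ σ) = lastOf β σ

Pointed-evRep' : ∀ α σ → Pointed (evRep' α σ) (lastOf α σ)
Pointed-evRep' α [] = one
Pointed-evRep' α (β ∷ σ) with any (sharesCᵇ α) (evRep' β σ) in shares
... | true  = cons (Any.map (λ {β′} → sharesCᵇ-sound α β′) (any⁻ _ _ (T-≡ .from shares)))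
                   (Pointed-evRep' β σ)
... | false = Pointed-evRep' β σ

length-evRep' : ∀ α σ → length (evRep' α σ) ≤ length (α ∷ σ)
length-evRep' α [] = ≤-refl
length-evRep' α (β ∷ σ) with any (sharesCᵇ α) (evRep' β σ)
... | true  = s≤s (length-evRep' β σ)
... | false = m≤n⇒m≤1+n (length-evRep' β σ)

count-evRep' : ∀ α σ → p ∈partC lastOf α σ → count p (evRep' α σ) ≡ count p (α ∷ σ)
count-evRep' α [] _ = refl
count-evRep' {p} α (β ∷ σ) p∈ω with any (sharesCᵇ α) (evRep' β σ) in shares | p ∈partC? α
... | true  | yes p∈α =
  trans (count-accept p∈α) (trans (cong suc (count-evRep' β σ p∈ω)) (sym (count-accept p∈α)))
... | true  | no p∉α  =
  trans (count-reject p∉α) (trans (count-evRep' β σ p∈ω) (sym (count-reject p∉α)))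
... | false | no p∉α  = trans (count-evRep' β σ p∈ω) (sym (count-reject p∉α))
... | false | yes p∈α = ⊥-elim (subst T shares α-shares)
  where
  α-shares : T (any (sharesCᵇ α) (evRep' β σ))
  α-shares = any⁺ _ (lose (Pointed-∈ (Pointed-evRep' β σ))
                           (sharesCᵇ-complete α (lastOf β σ) (p , p∈α , p∈ω)))

KDecomp-cons-reject : ¬ p ∈partC α → KDecomp p k τ → τ ≢ [] → KDecomp p k (α ∷ τ)
KDecomp-cons-reject _ nil τ≢[] = contradiction refl τ≢[]
KDecomp-cons-reject {p} {α} p∉α (cons σ₁ β τ p∉σ₁ p∈β kd) _ = cons (α ∷ σ₁) β τ p∉α∷σ₁ p∈β kd
  where
  p∉α∷σ₁ : p ∉part (α ∷ σ₁)
  p∉α∷σ₁ (_ , here refl , p∈α) = p∉α p∈α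
  p∉α∷σ₁ (γ , there γ∈σ₁ , p∈γ) = p∉σ₁ (γ , γ∈σ₁ , p∈γ)

∉part-[] : p ∉part []
∉part-[] (_ , () , _)

KDecomp-count⁻ : ∀ α σ → p ∈partC lastOf α σ → KDecomp p (count p (α ∷ σ)) (α ∷ σ)
KDecomp-count⁻ {p} α [] p∈α =
  subst (λ n → KDecomp p n (α ∷ [])) (sym (count-accept p∈α)) (cons [] α [] ∉part-[] p∈α nil)
KDecomp-count⁻ {p} α (β ∷ σ) p∈ω with p ∈partC? α
... | yes p∈α = subst (λ n → KDecomp p n (α ∷ β ∷ σ)) (sym (count-accept p∈α))
                  (cons [] α (β ∷ σ) ∉part-[] p∈α (KDecomp-count⁻ β σ p∈ω))
... | no p∉α  = subst (λ n → KDecomp p n (α ∷ β ∷ σ)) (sym (count-reject p∉α))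
                  (KDecomp-cons-reject p∉α (KDecomp-count⁻ β σ p∈ω) (λ ()))

KDecomp-∼evRep' : ∀ α σ → τ ∼ evRep' α σ → KDecomp p (suc k) τ → KDecomp p (suc k) (α ∷ σ)
KDecomp-∼evRep' {τ} {p} {k} α σ τ∼ev kd =
  subst (λ n → KDecomp p n (α ∷ σ)) count≡ (KDecomp-count⁻ α σ p∈ω)
  where
  p∈ω : p ∈partC lastOf α σ
  p∈ω = KDecomp-last kd (Pointed-resp-∼ (symmetric Swap τ∼ev) (Pointed-evRep' α σ))
  open ≡-Reasoning
  count≡ : count p (α ∷ σ) ≡ suc k
  count≡ = begin
    count p (α ∷ σ)      ≡⟨ count-evRep' α σ p∈ω ⟨
    count p (evRep' α σ) ≡⟨ count-resp-∼ τ∼ev ⟨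
    count p τ            ≡⟨ KDecomp-count kd ⟩
    suc k                ∎

length-∼evRep' : ∀ α σ → τ ∼ evRep' α σ → length τ ≤ length (α ∷ σ)
length-∼evRep' α σ τ∼ev = ≤-trans (≤-reflexive (length-resp-∼ τ∼ev)) (length-evRep' α σ)

All∃⇒∃All : {A : Set} {P : A → ℕ → Set} → (∀ {x m n} → m ≤ n → P x m → P x n) →
            ∀ {xs} → All (λ x → ∃ (P x)) xs → ∃[ M ] All (λ x → P x M) xs
All∃⇒∃All _ [] = 0 , []
All∃⇒∃All mono ((m , pm) ∷ pxs) with All∃⇒∃All mono pxs
... | M , pMs = m ⊔ M , mono (m≤m⊔n m M) pm ∷ All.map (mono (m≤n⊔m m M)) pMs

successors : ∀ {n} → Node n → List (Label × Fin n)
successors end          = []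
successors (msg _ _ bs) = bs

module _ (G : GlobalType) where

  private
    variable
      i j l : Fin (size G)
      n : ℕ

  Path-++ : Path G i σ j → Path G j τ l → Path G i (σ ++ τ) l
  Path-++ done π′ = π′
  Path-++ (step e b π) π′ = step e b (Path-++ π π′)

  Path-split : ∀ σ → Path G i (σ ++ τ) l → ∃[ j ] (Path G i σ j × Path G j τ l)
  Path-split [] π = _ , done , π
  Path-split (_ ∷ σ) (step e b π) with Path-split σ π
  ... | j , π₁ , π₂ = j , step e b π₁ , π₂

  Subtree-Path : Subtree G i → Path G i σ j → Subtree G j
  Subtree-Path (σ₀ , π₀) π = σ₀ ++ _ , Path-++ π₀ π

  step-successor : ∀ {p q bs x} → node G i ≡ msg p q bs → x ∈ bs → x ∈ successors (node G i)
  step-successor e x∈bs rewrite e = x∈bs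

  Within : ℕ → Fin (size G) → Fin (size G) → Set
  Within n i j = ∃[ σ ] (length σ ≤ n × Path G i σ j)

  Within-step : ∀ {x} → x ∈ successors (node G i) → Within n (proj₂ x) j → Within (suc n) i j
  Within-step {i} x∈ (σ , len , π) with node G i in e
  ... | msg p q _ = comm p q _ ∷ σ , s≤s len , step e x∈ π

  Within-uniform : {P : Fin (size G) → ℕ → Set} → (∀ {j m n} → m ≤ n → P j m → P j n) →
                   ∀ n i → (∀ {j} → Within n i j → ∃ (P j)) → ∃[ M ] (∀ {j} → Within n i j → P j M)
  Within-uniform mono zero i bound with bound ([] , z≤n , done)
  ... | M , pM = M , λ { ([] , _ , done) → pM }
  Within-uniform mono (suc n) i bound
    with bound ([] , z≤n , done)
       | All∃⇒∃All (λ m≤n pM {j′} w → mono m≤n (pM {j′} w))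
           (All.tabulate λ x∈ → Within-uniform mono n _ (bound ∘ Within-step x∈))
  ... | M₀ , pM₀ | M₁ , pM₁s = M₀ ⊔ M₁ , λ where
    ([] , _ , done)                   → mono (m≤m⊔n M₀ M₁) pM₀
    (_ ∷ σ , s≤s len , step e x∈ π) →
      mono (m≤n⊔m M₀ M₁) (All.lookup pM₁s (step-successor e x∈) (σ , len , π))

module _ (G : GlobalType) (bounded : Bounded G) (p : Participant) where

  KDepthBound : ℕ → Fin (size G) → ℕ → Set
  KDepthBound k i B = ∀ {σ j} → KDecomp p k σ → Path G i σ j → length σ ≤ B

  KDepthBound-mono : ∀ {k i m n} → m ≤ n → KDepthBound k i m → KDepthBound k i n
  KDepthBound-mono m≤n bound kd π = ≤-trans (bound kd π) m≤n

  KDepth-bounded : ∀ k i → Subtree G i → ∃ (KDepthBound k i)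
  KDepth-bounded zero _ _ = 0 , λ { nil _ → z≤n }
  KDepth-bounded (suc k) i sub
    with bounded p i sub
  ... | N , depth≤N
    with Within-uniform G KDepthBound-mono N i
           (λ (_ , _ , π) → KDepth-bounded k _ (Subtree-Path G sub π))
  ... | M , rest≤M = N + M , bound
    where
    bound : KDepthBound (suc k) i (N + M)
    bound (cons σ₁ α τ p∉σ₁ p∈α kd) π with Path-split G σ₁ π
    ... | _ , π₁ , step e b π₂ = begin
      length (σ₁ ++ α ∷ τ)       ≡⟨ length-++ σ₁ ⟩
      length σ₁ + suc (length τ) ≡⟨ +-suc (length σ₁) (length τ) ⟩
      suc (length σ₁) + length τ ≤⟨ +-mono-≤ head≤N (rest≤M head-within kd π₂) ⟩
      N + M                      ∎
      where
      open ≤-Reasoning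
      head≤N : suc (length σ₁) ≤ N
      head≤N = depth≤N σ₁ α τ ((λ ()) ∘ ++-conicalʳ σ₁ (α ∷ τ) , _ , π) p∉σ₁ p∈α
      head-within : Within G N i _
      head-within = σ₁ ∷ʳ α , ≤-trans (≤-reflexive (trans (length-++ σ₁) (+-comm _ 1))) head≤N
                  , Path-++ G π₁ (step e b done)

mainTheorem4 : (G : GlobalType) → Bounded G → SemBounded G
mainTheorem4 G bounded p _ k with KDepth-bounded G bounded p k (root G) ([] , done)
... | B , bound = B , λ where
  _ _ nil → z≤n
  _ ([] , ([]≢[] , _) , _) (cons _ _ _ _ _ _) → contradiction refl []≢[]
  τ (α ∷ σ , (_ , _ , π) , τ∼ev) kd@(cons _ _ _ _ _ _) →
    ≤-trans (length-∼evRep' α σ τ∼ev) (bound (KDecomp-∼evRep' α σ τ∼ev kd) π)
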